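{- Let $n\geq 3$ and let $A=\{a_1,\dots,a_k\}$ be either the set of all points of $E^n$ of even weight or the set of all points of $E^n$ of odd weight. Then for every $f\in M(A)$, the set $R_f=E^n-S_{A,(f(a_1),\dots,f(a_k))}$ is an antichain in $E^n$, so that the term $D(R_f)$ in $$D_n=\sum_{f\in M(A)} D\bigl(E^n-S_{A,(f(a_1),\dots,f(a_k))}\bigr)$$ equals $2^{|R_f|}$; i.e. $D_n$ is a sum of powers of $2$.
   Context: $E=\{0,1\}$ with $0\leq 1$; $E^n$ is the set of $n$-tuples over $E$ with the componentwise order; the weight $|a|$ of $a\in E^n$ is its number of $1$s. Monotone Boolean functions $f:E^n\to E$ satisfy $a\leq b\Rightarrow f(a)\leq f(b)$. For $T\subseteq E^n$, $M(T)$ is the set of distinct restrictions $f|_T$ of monotone Boolean functions on $E^n$, $D(T)=|M(T)|$, and $D_n=D(E^n)$ is the $n$-th Dedekind number. $S_{a,1}=\{b\in E^n: b\geq a\}$, $S_{a,0}=\{b\in E^n: b\leq a\}$, and for $A=\{a_1,\dots,a_k\}$, $y\in E^k$, $S_{A,y}=\bigcup_i S_{a_i,y^i}$. An antichain is a set of pairwise incomparable elements. -}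

module Defs where

open import Data.Bool using (Bool; true; false; not; _∧_; _∨_; if_then_else_)
import Data.Bool as B
open import Data.Bool.Properties using (_≤?_)
open import Data.Nat using (ℕ; zero; suc; _%_; _≡ᵇ_; _^_)
open import Data.Vec using (Vec; []; _∷_)
open import Data.List using (List; []; _∷_; map; _++_; filterᵇ; length)
open import Data.Bool.ListAction using (any)
open import Data.List.Membership.Propositional using (_∈_)
open import Data.List.Relation.Unary.Unique.Propositional using (Unique)
open import Data.Vec.Relation.Binary.Pointwise.Inductive using (Pointwise) renaming (decidable to pw-dec)
open import Data.Product using (Σ; ∃; _×_)
open import Function.Bundles using (_⇔_)
open import Relation.Nullary using (does)
open import Relation.Binary.PropositionalEquality using (_≡_)

-- E^n : points are Boolean vectors of length n (false = 0, true = 1).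
E : ℕ → Set
E n = Vec Bool n

_≤ᴱ_ : ∀ {n} → E n → E n → Set
_≤ᴱ_ = Pointwise B._≤_

_≤ᴱᵇ_ : ∀ {n} → E n → E n → Bool
a ≤ᴱᵇ b = does (pw-dec _≤?_ a b)

allPts : (n : ℕ) → List (E n)
allPts zero = [] ∷ []
allPts (suc n) = map (false ∷_) (allPts n) ++ map (true ∷_) (allPts n)

weight : ∀ {n} → E n → ℕ
weight [] = 0
weight (false ∷ a) = weight a
weight (true ∷ a) = suc (weight a)

Monotone : ∀ {n} → (E n → Bool) → Set
Monotone {n} F = ∀ (a b : E n) → a ≤ᴱ b → F a B.≤ F b

-- A_odd : membership in the set of points of even weight (odd = false)
-- or of odd weight (odd = true)
inA : ∀ {n} → Bool → E n → Bool
inA odd a = (weight a % 2) ≡ᵇ (if odd then 1 else 0)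

-- membership in S_{A,y} with y_i = F(a_i):  S_{a,1} = ↑a, S_{a,0} = ↓a
inS : ∀ {n} → Bool → (E n → Bool) → E n → Bool
inS {n} odd F b =
  any (λ a → inA odd a ∧ ((F a ∧ (a ≤ᴱᵇ b)) ∨ (not (F a) ∧ (b ≤ᴱᵇ a)))) (allPts n)

-- R_f = E^n − S_{A,(f(a_1),…,f(a_k))}, listed without repetition
R : ∀ {n} → Bool → (E n → Bool) → List (E n)
R {n} odd F = filterᵇ (λ b → not (inS odd F b)) (allPts n)

IsAntichain : ∀ {n} → List (E n) → Set
IsAntichain T = ∀ b c → b ∈ T → c ∈ T → b ≤ᴱ c → b ≡ c

-- a restriction of a function to T (T given as a list of points) is recorded
-- as the list of its values along T;  M(T) = restrictions of monotone functions
InM : ∀ {n} → List (E n) → List Bool → Set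
InM {n} T g = ∃ λ (F : E n → Bool) → Monotone F × Data.List.map F T ≡ g

-- D(T) = m :  M(T) has exactly m elements
HasD : ∀ {n} → List (E n) → ℕ → Set
HasD T m = Σ (List (List Bool)) λ L →
  Unique L × (∀ g → (g ∈ L) ⇔ InM T g) × length L ≡ m

{-# OPTIONS --safe #-}
module Submission where

-- A point b ∈ A lies in S_{b,f(b)}, so R_f avoids A; more generally no point of A lies between
-- two points of R_f.  If b < c in R_f, pick d with b < d ≤ c and |d| = |b| + 1: then d ∈ A by
-- parity, a contradiction, so R_f is an antichain.  On an antichain T every 0/1-assignment is the restriction of the monotone
-- indicator of the up-set generated by the points assigned 1, hence D(T) = 2^|T|.

open import Defs
open import Data.Bool using (Bool; true; false; not; _∧_; _∨_; if_then_else_; T)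
import Data.Bool as B
open import Data.Bool.Properties
  using (_≤?_; ≤-refl; ≤-trans; ≤-minimum; ≤-maximum; ≤-reflexive; T-not-≡; not-¬)
open import Data.Nat using (ℕ; zero; suc; _+_; _≥_; _^_; _%_; _≡ᵇ_)
open import Data.Nat.Properties using (+-identityʳ; suc-injective)
open import Data.Vec using (Vec; []; _∷_; toList; fromList)
open import Data.Vec.Relation.Binary.Equality.Cast using (cast-is-id)
open import Data.Vec.Properties using (∷-injectiveʳ; toList-injective; toList∘fromList; length-toList)
open import Data.List using (List; []; _∷_; length; map; _++_)
open import Data.List.Properties using (length-++; length-map; map-cong-local)
open import Data.List.Membership.Propositional using (_∈_; _∉_; lose)
open import Data.List.Membership.Propositional.Properties
  using (∈-map⁺; ∈-map⁻; ∈-++⁺ˡ; ∈-++⁺ʳ; ∈-filter⁻)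
open import Data.List.Relation.Unary.Any using (here; there)
open import Data.List.Relation.Unary.Any.Properties using (any⁺)
open import Data.List.Relation.Unary.All using (All; []; _∷_; lookup; tabulate)
open import Data.List.Relation.Unary.AllPairs using ([]; _∷_)
open import Data.List.Relation.Unary.Unique.Propositional using (Unique)
import Data.List.Relation.Unary.Unique.Propositional.Properties as Unique
open import Data.List.Relation.Binary.Disjoint.Propositional using (Disjoint)
open import Data.Vec.Relation.Binary.Pointwise.Inductive as Pointwise using ([]; _∷_; decidable)
open import Data.Product using (∃-syntax; _×_; _,_; proj₂)
open import Data.Sum using (_⊎_; inj₁; inj₂)
open import Data.Empty using (⊥-elim)
open import Function using (_∘_)
open import Function.Bundles using (Equivalence; mk⇔)
open import Relation.Nullary using (¬_; yes; no)
open import Relation.Nullary.Decidable using (dec-true; dec-false; T?)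
open import Relation.Binary.PropositionalEquality
  using (_≡_; refl; sym; trans; cong; cong₂; subst; module ≡-Reasoning)

open ≡-Reasoning

∨-mono-≤ : ∀ {a b c d} → a B.≤ b → c B.≤ d → a ∨ c B.≤ b ∨ d
∨-mono-≤ {true}  B.b≤b _ = B.b≤b
∨-mono-≤ {false} B.f≤t _ = ≤-maximum _
∨-mono-≤ {false} B.b≤b q = q

module _ {n : ℕ} where

  ≤ᴱ-refl : {a : E n} → a ≤ᴱ a
  ≤ᴱ-refl = Pointwise.refl ≤-refl

  ≤ᴱ-trans : {a b c : E n} → a ≤ᴱ b → b ≤ᴱ c → a ≤ᴱ c
  ≤ᴱ-trans = Pointwise.trans ≤-trans

  ≤ᴱ⇒≤ᴱᵇ≡true : {a b : E n} → a ≤ᴱ b → a ≤ᴱᵇ b ≡ true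
  ≤ᴱ⇒≤ᴱᵇ≡true = dec-true (decidable _≤?_ _ _)

  ≰ᴱ⇒≤ᴱᵇ≡false : {a b : E n} → ¬ a ≤ᴱ b → a ≤ᴱᵇ b ≡ false
  ≰ᴱ⇒≤ᴱᵇ≡false = dec-false (decidable _≤?_ _ _)

  ≤ᴱᵇ-monoʳ : {a x y : E n} → x ≤ᴱ y → (a ≤ᴱᵇ x) B.≤ (a ≤ᴱᵇ y)
  ≤ᴱᵇ-monoʳ {a} {x} x≤y with decidable _≤?_ a x
  ... | yes a≤x = ≤-reflexive (sym (≤ᴱ⇒≤ᴱᵇ≡true (≤ᴱ-trans a≤x x≤y)))
  ... | no _    = ≤-minimum _

≤ᴱ-cover : ∀ {n} {b c : E n} → b ≤ᴱ c →
  b ≡ c ⊎ ∃[ d ] (b ≤ᴱ d × d ≤ᴱ c × weight d ≡ suc (weight b))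
≤ᴱ-cover [] = inj₁ refl
≤ᴱ-cover {b = false ∷ b} (B.f≤t ∷ b≤c) = inj₂ (true ∷ b , B.f≤t ∷ ≤ᴱ-refl , B.b≤b ∷ b≤c , refl)
≤ᴱ-cover {b = x ∷ b} (B.b≤b ∷ b≤c) with ≤ᴱ-cover b≤c
... | inj₁ refl = inj₁ refl
... | inj₂ (d , b≤d , d≤c , cover) = inj₂ (x ∷ d , B.b≤b ∷ b≤d , B.b≤b ∷ d≤c , weight-cover x)
  where
  weight-cover : ∀ x → weight (x ∷ d) ≡ suc (weight (x ∷ b))
  weight-cover false = cover
  weight-cover true  = cong suc cover

%2-flip : ∀ odd w → (suc w % 2 ≡ᵇ (if odd then 1 else 0)) ≡ not (w % 2 ≡ᵇ (if odd then 1 else 0))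
%2-flip false zero          = refl
%2-flip true  zero          = refl
%2-flip false (suc zero)    = refl
%2-flip true  (suc zero)    = refl
%2-flip odd   (suc (suc w)) = %2-flip odd w

inA-cover : ∀ {n} odd {b d : E n} → weight d ≡ suc (weight b) → inA odd d ≡ not (inA odd b)
inA-cover odd {b} cover rewrite cover = %2-flip odd (weight b)

allPts-complete : ∀ {n} (a : E n) → a ∈ allPts n
allPts-complete []                  = here refl
allPts-complete {suc n} (false ∷ a) = ∈-++⁺ˡ (∈-map⁺ (false ∷_) (allPts-complete a))
allPts-complete {suc n} (true ∷ a)  = ∈-++⁺ʳ (map (false ∷_) (allPts n)) (∈-map⁺ (true ∷_) (allPts-complete a))

allPts-unique : ∀ n → Unique (allPts n)
allPts-unique zero    = [] ∷ []
allPts-unique (suc n) = Unique.++⁺ (Unique.map⁺ ∷-injectiveʳ u) (Unique.map⁺ ∷-injectiveʳ u) heads-differ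
  where
  u : Unique (allPts n)
  u = allPts-unique n
  heads-differ : Disjoint (map (false ∷_) (allPts n)) (map (true ∷_) (allPts n))
  heads-differ (v∈₀ , v∈₁) with ∈-map⁻ (false ∷_) v∈₀ | ∈-map⁻ (true ∷_) v∈₁
  ... | _ , _ , refl | _ , _ , ()

length-allPts : ∀ n → length (allPts n) ≡ 2 ^ n
length-allPts zero    = refl
length-allPts (suc n) = begin
  length (map (false ∷_) ps ++ map (true ∷_) ps)          ≡⟨ length-++ (map (false ∷_) ps) ⟩
  length (map (false ∷_) ps) + length (map (true ∷_) ps)  ≡⟨ cong₂ _+_ (length-map _ ps) (length-map _ ps) ⟩
  length ps + length ps                                    ≡⟨ cong (λ m → m + m) (length-allPts n) ⟩
  2 ^ n + 2 ^ n                                            ≡⟨ cong (2 ^ n +_) (sym (+-identityʳ (2 ^ n))) ⟩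
  2 ^ suc n                                                ∎
  where
  ps : List (E n)
  ps = allPts n

boolLists : ℕ → List (List Bool)
boolLists m = map toList (allPts m)

∈-boolLists⁺ : ∀ {m} {g : List Bool} → length g ≡ m → g ∈ boolLists m
∈-boolLists⁺ {g = g} refl =
  subst (_∈ boolLists (length g)) (toList∘fromList g) (∈-map⁺ toList (allPts-complete (fromList g)))

∈-boolLists⁻ : ∀ {m} {g : List Bool} → g ∈ boolLists m → length g ≡ m
∈-boolLists⁻ g∈ with ∈-map⁻ toList g∈
... | v , _ , refl = length-toList v

boolLists-unique : ∀ m → Unique (boolLists m)
boolLists-unique m = Unique.map⁺ toList-injectiveₘ (allPts-unique m)
  where
  toList-injectiveₘ : {u v : Vec Bool m} → toList u ≡ toList v → u ≡ v
  toList-injectiveₘ {u} {v} eq = trans (sym (cast-is-id refl u)) (toList-injective refl u v eq)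

length-boolLists : ∀ m → length (boolLists m) ≡ 2 ^ m
length-boolLists m = trans (length-map toList (allPts m)) (length-allPts m)

upClosure : ∀ {n} → List (E n) → List Bool → E n → Bool
upClosure (t ∷ ts) (true  ∷ g) x = (t ≤ᴱᵇ x) ∨ upClosure ts g x
upClosure (t ∷ ts) (false ∷ g) x = upClosure ts g x
upClosure _        _           _ = false

upClosure-mono : ∀ {n} (ts : List (E n)) g → Monotone (upClosure ts g)
upClosure-mono []       _           _ _ _   = B.b≤b
upClosure-mono (_ ∷ _)  []          _ _ _   = B.b≤b
upClosure-mono (t ∷ ts) (true ∷ g)  x y x≤y = ∨-mono-≤ (≤ᴱᵇ-monoʳ {a = t} x≤y) (upClosure-mono ts g x y x≤y)
upClosure-mono (t ∷ ts) (false ∷ g)         = upClosure-mono ts g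

upClosure-outside : ∀ {n} {x : E n} ts g → All (λ t → ¬ t ≤ᴱ x) ts → upClosure ts g x ≡ false
upClosure-outside []       _           _            = refl
upClosure-outside (_ ∷ _)  []          _            = refl
upClosure-outside (t ∷ ts) (true ∷ g)  (t≰x ∷ ts≰x) rewrite ≰ᴱ⇒≤ᴱᵇ≡false t≰x = upClosure-outside ts g ts≰x
upClosure-outside (t ∷ ts) (false ∷ g) (_ ∷ ts≰x)   = upClosure-outside ts g ts≰x

upClosure-∷-≰ : ∀ {n} {t x : E n} {ts g} bit → ¬ t ≤ᴱ x →
  upClosure (t ∷ ts) (bit ∷ g) x ≡ upClosure ts g x
upClosure-∷-≰ true  t≰x rewrite ≰ᴱ⇒≤ᴱᵇ≡false t≰x = refl
upClosure-∷-≰ false _   = refl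

upClosure-∷-head : ∀ {n} {t : E n} {ts g} bit → upClosure ts g t ≡ false →
  upClosure (t ∷ ts) (bit ∷ g) t ≡ bit
upClosure-∷-head {t = t} true _ rewrite ≤ᴱ⇒≤ᴱᵇ≡true (≤ᴱ-refl {a = t}) = refl
upClosure-∷-head false outside = outside

upClosure-restricts : ∀ {n} (ts : List (E n)) g → Unique ts → IsAntichain ts →
  length g ≡ length ts → map (upClosure ts g) ts ≡ g
upClosure-restricts []       []        _             _    _   = refl
upClosure-restricts (t ∷ ts) (bit ∷ g) (t∉ts ∷ uniq) anti len =
  cong₂ _∷_ (upClosure-∷-head bit (upClosure-outside ts g (tabulate ≰t))) (begin
    map (upClosure (t ∷ ts) (bit ∷ g)) ts ≡⟨ map-cong-local (tabulate (upClosure-∷-≰ bit ∘ t≰)) ⟩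
    map (upClosure ts g) ts              ≡⟨ upClosure-restricts ts g uniq anti-ts (suc-injective len) ⟩
    g                                    ∎)
  where
  t≰ : ∀ {u} → u ∈ ts → ¬ t ≤ᴱ u
  t≰ u∈ t≤u = lookup t∉ts u∈ (anti _ _ (here refl) (there u∈) t≤u)
  ≰t : ∀ {u} → u ∈ ts → ¬ u ≤ᴱ t
  ≰t u∈ u≤t = lookup t∉ts u∈ (sym (anti _ _ (there u∈) (here refl) u≤t))
  anti-ts : IsAntichain ts
  anti-ts b c b∈ c∈ = anti b c (there b∈) (there c∈)

antichain-D : ∀ {n} {ts : List (E n)} → Unique ts → IsAntichain ts → HasD ts (2 ^ length ts)
antichain-D {ts = ts} uniq anti =
  boolLists (length ts) , boolLists-unique _ , (λ _ → mk⇔ extend restrict) , length-boolLists (length ts)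
  where
  extend : ∀ {g} → g ∈ boolLists (length ts) → InM ts g
  extend {g} g∈ = upClosure ts g , upClosure-mono ts g , upClosure-restricts ts g uniq anti (∈-boolLists⁻ g∈)
  restrict : ∀ {g} → InM ts g → g ∈ boolLists (length ts)
  restrict (F , _ , refl) = ∈-boolLists⁺ (length-map F ts)

module _ {n : ℕ} (odd : Bool) (F : E n → Bool) where

  inS-at : E n → E n → Bool
  inS-at a b = inA odd a ∧ ((F a ∧ (a ≤ᴱᵇ b)) ∨ (not (F a) ∧ (b ≤ᴱᵇ a)))

  inS-intro : ∀ {a b} → inA odd a ≡ true → (F a ≡ true × a ≤ᴱ b) ⊎ (F a ≡ false × b ≤ᴱ a) →
    T (inS odd F b)
  inS-intro {a} {b} a∈A a≷b = any⁺ (λ a′ → inS-at a′ b) (lose (allPts-complete a) (at-a a≷b))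
    where
    at-a : (F a ≡ true × a ≤ᴱ b) ⊎ (F a ≡ false × b ≤ᴱ a) → T (inS-at a b)
    at-a (inj₁ (Fa , a≤b)) rewrite a∈A | Fa | ≤ᴱ⇒≤ᴱᵇ≡true a≤b = _
    at-a (inj₂ (Fa , b≤a)) rewrite a∈A | Fa | ≤ᴱ⇒≤ᴱᵇ≡true b≤a = _

  inS-∉R : ∀ {b : E n} → T (inS odd F b) → b ∉ R odd F
  inS-∉R {b} b∈S b∈R = subst T (Equivalence.to T-not-≡ b∉S) b∈S
    where
    b∉S : T (not (inS odd F b))
    b∉S = proj₂ (∈-filter⁻ (T? ∘ (not ∘ inS odd F)) {xs = allPts n} b∈R)

  R-between-∉A : ∀ {b c d} → b ∈ R odd F → c ∈ R odd F → b ≤ᴱ d → d ≤ᴱ c → inA odd d ≡ false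
  R-between-∉A {d = d} b∈R c∈R b≤d d≤c with inA odd d in d∈A | F d in Fd
  ... | false | _     = refl
  ... | true  | true  = ⊥-elim (inS-∉R (inS-intro d∈A (inj₁ (Fd , d≤c))) c∈R)
  ... | true  | false = ⊥-elim (inS-∉R (inS-intro d∈A (inj₂ (Fd , b≤d))) b∈R)

  R-antichain : IsAntichain (R odd F)
  R-antichain b c b∈R c∈R b≤c with ≤ᴱ-cover b≤c
  ... | inj₁ b≡c = b≡c
  ... | inj₂ (d , b≤d , d≤c , cover) =
    ⊥-elim (not-¬ d∉A (trans (inA-cover odd {b} {d} cover) (cong not b∉A)))
    where
    b∉A : inA odd b ≡ false
    b∉A = R-between-∉A b∈R b∈R ≤ᴱ-refl ≤ᴱ-refl
    d∉A : inA odd d ≡ false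
    d∉A = R-between-∉A b∈R c∈R b≤d d≤c

  R-unique : Unique (R odd F)
  R-unique = Unique.filter⁺ (T? ∘ (not ∘ inS odd F)) (allPts-unique n)

theorem4 : (n : ℕ) → n ≥ 3 → (odd : Bool) → (F : E n → Bool) → Monotone F →
    IsAntichain (R odd F) × HasD (R odd F) (2 ^ length (R odd F))
theorem4 n _ odd F _ = R-antichain odd F , antichain-D (R-unique odd F) (R-antichain odd F)
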